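{- Let $m,n$ be positive integers, $A=(a_{i,j})\in\mathcal{M}_{n,m}(\mathbb{F}_q((z^{ -1})))$, let $L_i(\underline{x})=\sum_{j=1}^m a_{i,j}x_j$ ($1\le i\le n$) and $M_j(\underline{u})=\sum_{i=1}^n a_{i,j}u_i$ ($1\le j\le m$). Let $(\alpha_1,\dots,\alpha_n)\in\mathbb{F}_q((z^{ -1}))^n$ and let $s,t$ be positive integers. Suppose that $$|\langle u_1\alpha_1+\cdots+u_n\alpha_n\rangle|\le\max\Big\{q^t\max_{1\le j\le m}|\langle M_j(\underline{u})\rangle|,\ q^{ -s}\max_{1\le i\le n}\|u_i\|\Big\}$$ holds for all $\underline{u}=(u_1,\dots,u_n)\in\mathbb{F}_q[z]^n$. Then there exists $\underline{b}=(b_1,\dots,b_m)\in\mathbb{F}_q[z]^m$ with $|\langle L_i(\underline{b})-\alpha_i\rangle|\le q^{ -s}$ for $1\le i\le n$ and $\|b_j\|\le q^t$ for $1\le j\le m$.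
   Context: Let $q$ be a prime power, $\mathbb{F}_q[z]$ the polynomial ring over $\mathbb{F}_q$, $\mathbb{F}_q((z^{ -1}))$ the field of formal Laurent series in $z^{ -1}$, with $\|x\|=q^{\deg x}$ for $x\ne0$, $\|0\|=0$; $|\langle x\rangle|=\min_{y\in\mathbb{F}_q[z]}\|x-y\|$. -}

module Defs where

open import Level using (Level; _⊔_) renaming (suc to lsuc)
open import Data.Nat using (ℕ; zero; suc)
open import Data.Fin using (Fin; zero; suc)
open import Data.Integer using (ℤ; +_; -[1+_]; _<_; _<?_; 0ℤ)
import Data.Integer as ℤ
open import Data.List using (List; []; _∷_)
open import Data.Product using (Σ; ∃; _,_)
open import Data.Bool using (if_then_else_)
open import Relation.Nullary using (¬_; does)
open import Relation.Binary.PropositionalEquality using (_≡_)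
open import Relation.Binary.Definitions using (Decidable)
open import Algebra.Bundles using (CommutativeRing)

-- A finite field: a commutative ring with 0 ≠ 1 in which every nonzero element
-- is invertible, with decidable equality, and whose carrier is in bijection
-- (up to ≈) with Fin q.  (Every finite field has prime-power order q, so this
-- is exactly "F_q for a prime power q".)
record FiniteField (c ℓ : Level) : Set (lsuc (c ⊔ ℓ)) where
  field
    commRing : CommutativeRing c ℓ
  open CommutativeRing commRing public
  field
    0≉1     : ¬ (0# ≈ 1#)
    inverse : ∀ x → ¬ (x ≈ 0#) → Σ Carrier (λ y → x * y ≈ 1#)
    _≟_     : Decidable _≈_
    q       : ℕ
    enum    : Fin q → Carrier
    enum-surj : ∀ x → ∃ (λ i → enum i ≈ x)
    enum-inj  : ∀ i j → enum i ≈ enum j → i ≡ j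

module FieldOps {c ℓ : Level} (F : FiniteField c ℓ) where
  open FiniteField F using (Carrier; _≈_; _+_; _*_; -_; 0#)

  -- A (raw) formal Laurent series: f k is the coefficient of z^k.
  Series : Set c
  Series = ℤ → Carrier

  -- An element of F_q((z^{-1})): coefficients vanish above some bound.
  IsLaurent : Series → Set ℓ
  IsLaurent f = ∃ (λ N → ∀ k → N < k → f k ≈ 0#)

  -- Polynomials in F_q[z] as coefficient lists c₀ ∷ c₁ ∷ … (ascending powers).
  Poly : Set c
  Poly = List Carrier

  pcoeff : Poly → ℤ → Carrier
  pcoeff []       _           = 0#
  pcoeff (a ∷ p)  (+ zero)    = a
  pcoeff (a ∷ p)  (+ (suc k)) = pcoeff p (+ k)
  pcoeff (a ∷ p)  -[1+ k ]    = 0#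

  polyS : Poly → Series
  polyS = pcoeff

  _⊕_ : Series → Series → Series
  (f ⊕ g) k = f k + g k

  _⊖_ : Series → Series → Series
  (f ⊖ g) k = f k + (- g k)

  zeroS : Series
  zeroS _ = 0#

  -- product of a polynomial with a Laurent series:
  -- (a + z p) · f has z^k-coefficient a f_k + (p f)_{k-1}
  _⊙_ : Poly → Series → Series
  ([]    ⊙ f) k = 0#
  ((a ∷ p) ⊙ f) k = a * f k + (p ⊙ f) (k ℤ.- + 1)

  sumS : (n : ℕ) → (Fin n → Series) → Series
  sumS zero    f = zeroS
  sumS (suc n) f = f zero ⊕ sumS n (λ i → f (suc i))

  -- fractional part ⟨x⟩: the part with negative powers of z; one has
  -- |⟨x⟩| = min_{y ∈ F_q[z]} ‖x − y‖ = ‖frac x‖ (the minimum is attained at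
  -- the polynomial part of x).
  frac : Series → Series
  frac f k = if does (k <? 0ℤ) then f k else 0#

  -- ‖f‖ ≤ q^e   (for e ∈ ℤ)
  NormLE : Series → ℤ → Set ℓ
  NormLE f e = ∀ k → e < k → f k ≈ 0#

  PNormLE : Poly → ℤ → Set ℓ
  PNormLE p e = NormLE (polyS p) e

  FracLE : Series → ℤ → Set ℓ
  FracLE f e = NormLE (frac f) e

  Lform : (n m : ℕ) → (Fin n → Fin m → Series) → (Fin m → Poly) → Fin n → Series
  Lform n m A b i = sumS m (λ j → b j ⊙ A i j)

  Mform : (n m : ℕ) → (Fin n → Fin m → Series) → (Fin n → Poly) → Fin m → Series
  Mform n m A u j = sumS n (λ i → u i ⊙ A i j)

  uDotα : (n : ℕ) → (Fin n → Poly) → (Fin n → Series) → Series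
  uDotα n u α = sumS n (λ i → u i ⊙ α i)

{-# OPTIONS --safe #-}
-- Write b_j = Σ_{d ≤ t} x_{j,d} z^d with unknown x_{j,d} ∈ F_q.  The conclusion only asks
-- that the coefficients of z^{-1}, …, z^{-(s-1)} of L_i(b) − α_i vanish: a finite linear
-- system over F_q.  By the Fredholm alternative it is either solvable, or some family
-- μ_{i,r} annihilates every column but pairs nontrivially with the right-hand side.  In the
-- latter case u_i = Σ_{r < s-1} μ_{i,r} z^r has ‖u_i‖ ≤ q^{s-2} and |⟨M_j(u)⟩| ≤ q^{-t-2},
-- so the hypothesis with e = −t−2 kills the z^{-1}-coefficient of u·α, which is exactly that
-- nontrivial pairing.  Only finitely many coefficients of A and α enter.
module Submission where

open import Defs

open import Level using (Level; _⊔_)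
open import Data.Nat as ℕ using (ℕ; zero; suc; z≤n; s≤s; _≤_)
import Data.Nat.Properties as ℕ
open import Data.Integer as ℤ using (ℤ; +_; -[1+_]; _<_; -<-; +<+)
import Data.Integer.Properties as ℤ
open import Data.Fin as Fin using (Fin; zero; suc; toℕ; fromℕ<)
open import Data.Fin.Properties using (suc-injective; toℕ-fromℕ<)
open import Data.List using (List; []; _∷_; allFin; cartesianProduct; tabulate)
open import Data.List.Membership.Propositional using (_∈_)
open import Data.List.Membership.Propositional.Properties using (∈-allFin; ∈-cartesianProduct⁺)
open import Data.List.Relation.Unary.Any using (here; there; satisfied)
import Data.List.Relation.Unary.All as All
open import Data.List.Relation.Unary.All.Properties using (¬All⇒Any¬)
open import Data.Product using (Σ; ∃; _×_; _,_; proj₁; proj₂)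
open import Data.Product.Properties using (≡-dec)
open import Data.Sum as Sum using (_⊎_; inj₁; inj₂)
open import Data.Empty using (⊥-elim)
open import Function using (_∘_)
open import Relation.Nullary using (¬_; yes; no)
open import Relation.Binary.Definitions using (Decidable; DecidableEquality)
open import Relation.Binary.PropositionalEquality as ≡ using (_≡_; _≢_)
open import Algebra.Bundles using (CommutativeRing)

module LinearAlgebra {c ℓ} (K : CommutativeRing c ℓ) where

  open CommutativeRing K hiding (zero)

  open import Relation.Binary.Reasoning.Setoid setoid
  import Algebra.Properties.Semiring.Sum semiring as Vec

  record FiniteIndex (X : Set) : Set (c ⊔ ℓ) where
    field
      ∑              : (X → Carrier) → Carrier
      ∑-cong         : ∀ {f g} → (∀ x → f x ≈ g x) → ∑ f ≈ ∑ g
      ∑-distrib-+    : ∀ f g → ∑ (λ x → f x + g x) ≈ ∑ f + ∑ g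
      *-distribˡ-∑   : ∀ a f → a * ∑ f ≈ ∑ (λ x → a * f x)
      ∑-supported-at : ∀ v f → (∀ x → x ≢ v → f x ≈ 0#) → ∑ f ≈ f v
      _≟ᵢ_           : DecidableEquality X
      elements       : List X
      ∈-elements     : ∀ x → x ∈ elements

    ∑-zero : ∑ (λ _ → 0#) ≈ 0#
    ∑-zero = begin
      ∑ (λ _ → 0#)      ≈⟨ ∑-cong (λ _ → sym (zeroˡ 0#)) ⟩
      ∑ (λ _ → 0# * 0#) ≈⟨ *-distribˡ-∑ 0# (λ _ → 0#) ⟨
      0# * ∑ (λ _ → 0#) ≈⟨ zeroˡ _ ⟩
      0#                ∎

    ∑-linear : ∀ a f g → ∑ (λ x → f x + a * g x) ≈ ∑ f + a * ∑ g
    ∑-linear a f g = trans (∑-distrib-+ f _) (+-congˡ (sym (*-distribˡ-∑ a g)))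

    indicator : X → Carrier → X → Carrier
    indicator v a x with x ≟ᵢ v
    ... | yes _ = a
    ... | no _  = 0#

    indicator-at : ∀ v a → indicator v a v ≡ a
    indicator-at v a with v ≟ᵢ v
    ... | yes _ = ≡.refl
    ... | no v≢v = ⊥-elim (v≢v ≡.refl)

    indicator-off : ∀ v a x → x ≢ v → indicator v a x ≡ 0#
    indicator-off v a x x≢v with x ≟ᵢ v
    ... | yes x≡v = ⊥-elim (x≢v x≡v)
    ... | no _    = ≡.refl

    ∑-indicator-* : ∀ (v : X) a (f : X → Carrier) → ∑ (λ x → indicator v a x * f x) ≈ a * f v
    ∑-indicator-* v a f = trans
      (∑-supported-at v _ (λ x x≢v → trans (*-congʳ (reflexive (indicator-off v a x x≢v))) (zeroˡ _)))
      (*-congʳ (reflexive (indicator-at v a)))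

    ∑-*-indicator : ∀ (v : X) a (f : X → Carrier) → ∑ (λ x → f x * indicator v a x) ≈ f v * a
    ∑-*-indicator v a f = trans (∑-cong (λ x → *-comm (f x) _))
      (trans (∑-indicator-* v a f) (*-comm a (f v)))



  ∑-supported-at-Fin : ∀ {n} v (f : Fin n → Carrier) → (∀ x → x ≢ v → f x ≈ 0#) → Vec.sum f ≈ f v
  ∑-supported-at-Fin {suc n} zero f vanishes = begin
    f zero + Vec.sum (f ∘ suc) ≈⟨ +-congˡ (Vec.sum-cong-≋ (λ i → vanishes (suc i) (λ ()))) ⟩
    f zero + Vec.sum {n} (λ _ → 0#) ≈⟨ +-congˡ (Vec.sum-replicate-zero n) ⟩
    f zero + 0#                ≈⟨ +-identityʳ _ ⟩
    f zero                     ∎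
  ∑-supported-at-Fin (suc v) f vanishes = begin
    f zero + Vec.sum (f ∘ suc) ≈⟨ +-congʳ (vanishes zero (λ ())) ⟩
    0# + Vec.sum (f ∘ suc)     ≈⟨ +-identityˡ _ ⟩
    Vec.sum (f ∘ suc)
      ≈⟨ ∑-supported-at-Fin v (f ∘ suc) (λ i i≢v → vanishes (suc i) (i≢v ∘ suc-injective)) ⟩
    f (suc v)                  ∎

  finIndex : ∀ n → FiniteIndex (Fin n)
  finIndex n = record
    { ∑              = Vec.sum
    ; ∑-cong         = Vec.sum-cong-≋
    ; ∑-distrib-+    = Vec.∑-distrib-+
    ; *-distribˡ-∑   = Vec.*-distribˡ-sum
    ; ∑-supported-at = ∑-supported-at-Fin
    ; _≟ᵢ_           = Fin._≟_
    ; elements       = allFin n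
    ; ∈-elements     = ∈-allFin
    }

  ×-finiteIndex : ∀ {A B} → FiniteIndex A → FiniteIndex B → FiniteIndex (A × B)
  ×-finiteIndex IA IB = record
    { ∑              = λ f → A.∑ (λ a → B.∑ (λ b → f (a , b)))
    ; ∑-cong         = λ f≈g → A.∑-cong (λ a → B.∑-cong (λ b → f≈g (a , b)))
    ; ∑-distrib-+    = λ f g → trans (A.∑-cong (λ a → B.∑-distrib-+ _ _)) (A.∑-distrib-+ _ _)
    ; *-distribˡ-∑   = λ x f → trans (A.*-distribˡ-∑ x _) (A.∑-cong (λ a → B.*-distribˡ-∑ x _))
    ; ∑-supported-at = supported-at
    ; _≟ᵢ_           = ≡-dec A._≟ᵢ_ B._≟ᵢ_
    ; elements       = cartesianProduct A.elements B.elements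
    ; ∈-elements     = λ (a , b) → ∈-cartesianProduct⁺ (A.∈-elements a) (B.∈-elements b)
    }
    where
    module A = FiniteIndex IA
    module B = FiniteIndex IB
    supported-at : ∀ v f → (∀ x → x ≢ v → f x ≈ 0#) → A.∑ (λ a → B.∑ (λ b → f (a , b))) ≈ f v
    supported-at (a₀ , b₀) f vanishes = trans
      (A.∑-supported-at a₀ _ (λ a a≢a₀ →
        trans (B.∑-cong (λ b → vanishes (a , b) (a≢a₀ ∘ ≡.cong proj₁))) B.∑-zero))
      (B.∑-supported-at b₀ _ (λ b b≢b₀ → vanishes (a₀ , b) (b≢b₀ ∘ ≡.cong proj₂)))

  module FredholmAlternative
    (_≟_ : Decidable _≈_)
    (inverse : ∀ x → ¬ x ≈ 0# → Σ Carrier λ y → x * y ≈ 1#)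
    where

    open import Algebra.Properties.Ring ring using (-‿distribˡ-*)
    open import Algebra.Properties.AbelianGroup +-abelianGroup
      using (ε⁻¹≈ε; //-rightDividesˡ; x≈z//y; x≈y⇒x∙y⁻¹≈ε)

    allZero⊎nonzero : ∀ {X} → FiniteIndex X → (f : X → Carrier) →
                      (∀ x → f x ≈ 0#) ⊎ ∃ λ x → ¬ f x ≈ 0#
    allZero⊎nonzero I f with All.all? (λ x → f x ≟ 0#) (FiniteIndex.elements I)
    ... | yes all0 = inj₁ (λ x → All.lookup all0 (FiniteIndex.∈-elements I x))
    ... | no ¬all0 = inj₂ (satisfied (¬All⇒Any¬ (λ x → f x ≟ 0#) (FiniteIndex.elements I) ¬all0))

    module _ {R X : Set} (IR : FiniteIndex R) (IX : FiniteIndex X) where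
      private
        module Row = FiniteIndex IR
        module Col = FiniteIndex IX

      Solution : (R → X → Carrier) → (R → Carrier) → Set (c ⊔ ℓ)
      Solution A y = Σ (X → Carrier) λ x → ∀ r → Col.∑ (λ v → A r v * x v) ≈ y r

      Obstruction : (R → X → Carrier) → (R → Carrier) → Set (c ⊔ ℓ)
      Obstruction A y = Σ (R → Carrier) λ μ →
        (∀ v → Row.∑ (λ r → μ r * A r v) ≈ 0#) × ¬ Row.∑ (λ r → μ r * y r) ≈ 0#

      SupportedOn : List X → (R → X → Carrier) → Set ℓ
      SupportedOn vs A = ∀ r v → ¬ A r v ≈ 0# → v ∈ vs

      zero-system-alternative : ∀ A y → (∀ r v → A r v ≈ 0#) → Solution A y ⊎ Obstruction A y
      zero-system-alternative A y A≈0 with allZero⊎nonzero IR y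
      ... | inj₁ y≈0 = inj₁ ((λ _ → 0#) , λ r → begin
        Col.∑ (λ v → A r v * 0#) ≈⟨ Col.∑-cong (λ v → zeroʳ _) ⟩
        Col.∑ (λ _ → 0#)         ≈⟨ Col.∑-zero ⟩
        0#                       ≈⟨ y≈0 r ⟨
        y r                      ∎)
      ... | inj₂ (r₀ , yr₀≉0) = inj₂ (Row.indicator r₀ 1# , annihilates , yr₀≉0 ∘ pairs)
        where
        annihilates : ∀ v → Row.∑ (λ r → Row.indicator r₀ 1# r * A r v) ≈ 0#
        annihilates v = trans (Row.∑-indicator-* r₀ 1# _) (trans (*-identityˡ _) (A≈0 r₀ v))
        pairs : Row.∑ (λ r → Row.indicator r₀ 1# r * y r) ≈ 0# → y r₀ ≈ 0#
        pairs e = trans (sym (trans (Row.∑-indicator-* r₀ 1# y) (*-identityˡ _))) e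

      -- The row operation g ↦ g − κ·g(p) is adjoint to μ ↦ μ − (Σ μκ)·1_p.
      transfer-pairing : ∀ (μ κ g : R → Carrier) p →
        Row.∑ (λ r → (μ r + Row.indicator p (- Row.∑ (λ r → μ r * κ r)) r) * g r)
          ≈ Row.∑ (λ r → μ r * (g r - κ r * g p))
      transfer-pairing μ κ g p = trans lhs (sym rhs)
        where
        Σμκ = Row.∑ (λ r → μ r * κ r)
        lhs : Row.∑ (λ r → (μ r + Row.indicator p (- Σμκ) r) * g r)
                ≈ Row.∑ (λ r → μ r * g r) - Σμκ * g p
        lhs = begin
          Row.∑ (λ r → (μ r + Row.indicator p (- Σμκ) r) * g r)
            ≈⟨ Row.∑-cong (λ r → distribʳ (g r) _ _) ⟩
          Row.∑ (λ r → μ r * g r + Row.indicator p (- Σμκ) r * g r)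
            ≈⟨ Row.∑-distrib-+ _ _ ⟩
          Row.∑ (λ r → μ r * g r) + Row.∑ (λ r → Row.indicator p (- Σμκ) r * g r)
            ≈⟨ +-congˡ (Row.∑-indicator-* p (- Σμκ) g) ⟩
          Row.∑ (λ r → μ r * g r) + - Σμκ * g p
            ≈⟨ +-congˡ (-‿distribˡ-* Σμκ (g p)) ⟨
          Row.∑ (λ r → μ r * g r) - Σμκ * g p ∎
        termwise : ∀ r → μ r * (g r - κ r * g p) + g p * (μ r * κ r) ≈ μ r * g r
        termwise r = begin
          μ r * (g r - κ r * g p) + g p * (μ r * κ r) ≈⟨ +-congˡ (trans (*-comm _ _) (*-assoc _ _ _)) ⟩
          μ r * (g r - κ r * g p) + μ r * (κ r * g p) ≈⟨ distribˡ _ _ _ ⟨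
          μ r * (g r - κ r * g p + κ r * g p)         ≈⟨ *-congˡ (//-rightDividesˡ _ _) ⟩
          μ r * g r                                   ∎
        rhs : Row.∑ (λ r → μ r * (g r - κ r * g p)) ≈ Row.∑ (λ r → μ r * g r) - Σμκ * g p
        rhs = x≈z//y _ _ _ (begin
          Row.∑ (λ r → μ r * (g r - κ r * g p)) + Σμκ * g p
            ≈⟨ +-congˡ (*-comm _ _) ⟩
          Row.∑ (λ r → μ r * (g r - κ r * g p)) + g p * Σμκ
            ≈⟨ Row.∑-linear (g p) _ _ ⟨
          Row.∑ (λ r → μ r * (g r - κ r * g p) + g p * (μ r * κ r))
            ≈⟨ Row.∑-cong termwise ⟩
          Row.∑ (λ r → μ r * g r) ∎)

      module Pivot (A : R → X → Carrier) (y : R → Carrier)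
                   {p : R} {w : X} {pivot⁻¹ : Carrier} (invertible : A p w * pivot⁻¹ ≈ 1#) where

        factor : R → Carrier
        factor r = A r w * pivot⁻¹

        A′ : R → X → Carrier
        A′ r v = A r v - factor r * A p v

        y′ : R → Carrier
        y′ r = y r - factor r * y p

        A′-clears-pivot-column : ∀ r → A′ r w ≈ 0#
        A′-clears-pivot-column r = x≈y⇒x∙y⁻¹≈ε (sym (begin
          A r w * pivot⁻¹ * A p w   ≈⟨ *-assoc _ _ _ ⟩
          A r w * (pivot⁻¹ * A p w) ≈⟨ *-congˡ (trans (*-comm _ _) invertible) ⟩
          A r w * 1#                ≈⟨ *-identityʳ _ ⟩
          A r w                     ∎))

        A′≈A : ∀ {r v} → A p v ≈ 0# → A′ r v ≈ A r v
        A′≈A {r} {v} Apv≈0 = begin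
          A r v - factor r * A p v ≈⟨ +-congˡ (-‿cong (trans (*-congˡ Apv≈0) (zeroʳ _))) ⟩
          A r v - 0#               ≈⟨ +-congˡ ε⁻¹≈ε ⟩
          A r v + 0#               ≈⟨ +-identityʳ _ ⟩
          A r v                    ∎

        A-nonzero-in-column : ∀ {r v} → ¬ A′ r v ≈ 0# → ∃ λ r′ → ¬ A r′ v ≈ 0#
        A-nonzero-in-column {r} {v} A′rv≉0 with A p v ≟ 0#
        ... | yes Apv≈0 = r , λ Arv≈0 → A′rv≉0 (trans (A′≈A Apv≈0) Arv≈0)
        ... | no Apv≉0  = p , Apv≉0

        supportedOn-A′ : ∀ {ws} → SupportedOn (w ∷ ws) A → SupportedOn ws A′
        supportedOn-A′ supported r v A′rv≉0
          with supported _ v (proj₂ (A-nonzero-in-column A′rv≉0))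
        ... | here ≡.refl = ⊥-elim (A′rv≉0 (A′-clears-pivot-column r))
        ... | there v∈ws  = v∈ws

        lift-solution : Solution A′ y′ → Solution A y
        lift-solution (x′ , solves) = x , solves-A
          where
          S = Col.∑ (λ v → A p v * x′ v)
          δ = (y p - S) * pivot⁻¹
          x : X → Carrier
          x v = x′ v + Col.indicator w δ v
          expand : ∀ r → Col.∑ (λ v → A r v * x′ v) ≈ y′ r + factor r * S
          expand r = begin
            Col.∑ (λ v → A r v * x′ v)
              ≈⟨ Col.∑-cong (λ v → *-congʳ (//-rightDividesˡ _ _)) ⟨
            Col.∑ (λ v → (A′ r v + factor r * A p v) * x′ v)
              ≈⟨ Col.∑-cong (λ v → trans (distribʳ _ _ _) (+-congˡ (*-assoc _ _ _))) ⟩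
            Col.∑ (λ v → A′ r v * x′ v + factor r * (A p v * x′ v))
              ≈⟨ Col.∑-linear (factor r) _ _ ⟩
            Col.∑ (λ v → A′ r v * x′ v) + factor r * S
              ≈⟨ +-congʳ (solves r) ⟩
            y′ r + factor r * S ∎
          solves-A : ∀ r → Col.∑ (λ v → A r v * x v) ≈ y r
          solves-A r = begin
            Col.∑ (λ v → A r v * (x′ v + Col.indicator w δ v))
              ≈⟨ Col.∑-cong (λ v → distribˡ _ _ _) ⟩
            Col.∑ (λ v → A r v * x′ v + A r v * Col.indicator w δ v)
              ≈⟨ Col.∑-distrib-+ _ _ ⟩
            Col.∑ (λ v → A r v * x′ v) + Col.∑ (λ v → A r v * Col.indicator w δ v)
              ≈⟨ +-cong (expand r) (Col.∑-*-indicator w δ (A r)) ⟩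
            y′ r + factor r * S + A r w * δ
              ≈⟨ +-assoc _ _ _ ⟩
            y′ r + (factor r * S + A r w * ((y p - S) * pivot⁻¹))
              ≈⟨ +-congˡ (+-congˡ (trans (*-congˡ (*-comm _ _)) (sym (*-assoc _ _ _)))) ⟩
            y′ r + (factor r * S + factor r * (y p - S))
              ≈⟨ +-congˡ (distribˡ _ _ _) ⟨
            y′ r + factor r * (S + (y p - S))
              ≈⟨ +-congˡ (*-congˡ (trans (+-comm _ _) (//-rightDividesˡ _ _))) ⟩
            y′ r + factor r * y p
              ≈⟨ //-rightDividesˡ _ _ ⟩
            y r ∎

        lift-obstruction : Obstruction A′ y′ → Obstruction A y
        lift-obstruction (μ′ , annihilates , y′-unpaired) =
          μ , (λ v → trans (transfer-pairing μ′ factor (λ r → A r v) p) (annihilates v))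
            , y′-unpaired ∘ trans (sym (transfer-pairing μ′ factor y p))
          where
          μ : R → Carrier
          μ r = μ′ r + Row.indicator p (- Row.∑ (λ r → μ′ r * factor r)) r

      fredholm-on : ∀ vs A y → SupportedOn vs A → Solution A y ⊎ Obstruction A y
      fredholm-on [] A y supported = zero-system-alternative A y vanishes
        where
        vanishes : ∀ r v → A r v ≈ 0#
        vanishes r v with A r v ≟ 0#
        ... | yes Arv≈0 = Arv≈0
        ... | no Arv≉0 with () ← supported r v Arv≉0
      fredholm-on (w ∷ ws) A y supported with allZero⊎nonzero IR (λ r → A r w)
      ... | inj₁ column≈0 = fredholm-on ws A y supported′
        where
        supported′ : SupportedOn ws A
        supported′ r v Arv≉0 with supported r v Arv≉0
        ... | here ≡.refl = ⊥-elim (Arv≉0 (column≈0 r))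
        ... | there v∈ws  = v∈ws
      ... | inj₂ (p , Apw≉0) with inverse (A p w) Apw≉0
      ...   | pivot⁻¹ , invertible = Sum.map lift-solution lift-obstruction
                                     (fredholm-on ws A′ y′ (supportedOn-A′ supported))
        where open Pivot A y invertible

      fredholm-alternative : ∀ A y → Solution A y ⊎ Obstruction A y
      fredholm-alternative A y = fredholm-on Col.elements A y (λ _ v _ → Col.∈-elements v)

module _ {c ℓ} (F : FiniteField c ℓ) where
  open FiniteField F hiding (zero)
  open FieldOps F
  open LinearAlgebra commRing
  open LinearAlgebra.FredholmAlternative commRing _≟_ inverse
  open import Relation.Binary.Reasoning.Setoid setoid
  open import Algebra.Properties.Semiring.Sum semiring using (sum; sum-cong-≗)

  coeff-sumS : ∀ N (f : Fin N → Series) k → sumS N f k ≡ sum (λ i → f i k)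
  coeff-sumS zero    f k = ≡.refl
  coeff-sumS (suc N) f k = ≡.cong (_+_ (f zero k)) (coeff-sumS N (f ∘ suc) k)

  coeff-tabulate-⊙ : ∀ L (g : Fin L → Carrier) f r →
    (tabulate g ⊙ f) -[1+ r ] ≡ sum (λ d → g d * f -[1+ (r ℕ.+ toℕ d) ])
  coeff-tabulate-⊙ zero    g f r = ≡.refl
  coeff-tabulate-⊙ (suc L) g f r = ≡.cong₂ _+_
    (≡.cong (λ k → g zero * f -[1+ k ]) (≡.sym (ℕ.+-identityʳ r)))
    (≡.trans (≡.cong (tabulate (g ∘ suc) ⊙ f) (≡.cong (λ k → -[1+ suc k ]) (ℕ.+-identityʳ r)))
      (≡.trans (coeff-tabulate-⊙ L (g ∘ suc) f (suc r))
        (sum-cong-≗ (λ d → ≡.cong (λ k → g (suc d) * f -[1+ k ]) (≡.sym (ℕ.+-suc r (toℕ d)))))))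

  coeff-combination : ∀ N L (g : Fin N → Fin L → Carrier) (f : Fin N → Series) r →
    sumS N (λ i → tabulate (g i) ⊙ f i) -[1+ r ]
      ≡ sum (λ i → sum (λ d → g i d * f i -[1+ (r ℕ.+ toℕ d) ]))
  coeff-combination N L g f r = ≡.trans (coeff-sumS N _ _)
    (sum-cong-≗ (λ i → coeff-tabulate-⊙ L (g i) (f i) r))

  pcoeff-negative : ∀ p k → pcoeff p -[1+ k ] ≡ 0#
  pcoeff-negative []      k = ≡.refl
  pcoeff-negative (_ ∷ _) k = ≡.refl

  pcoeff-tabulate-≥ : ∀ L (g : Fin L → Carrier) {n} → L ℕ.≤ n → pcoeff (tabulate g) (+ n) ≡ 0#
  pcoeff-tabulate-≥ zero    g _          = ≡.refl
  pcoeff-tabulate-≥ (suc L) g (s≤s L≤n) = pcoeff-tabulate-≥ L (g ∘ suc) L≤n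

  PNormLE-tabulate : ∀ L (g : Fin L → Carrier) → PNormLE (tabulate g) (+ L ℤ.- + 1)
  PNormLE-tabulate L g -[1+ k ] _       = reflexive (pcoeff-negative (tabulate g) k)
  PNormLE-tabulate L g (+ n)    L-1<n = reflexive (pcoeff-tabulate-≥ L g (bound L L-1<n))
    where
    bound : ∀ L {n} → + L ℤ.- + 1 < + n → L ℕ.≤ n
    bound zero    _           = z≤n
    bound (suc L) (+<+ L<n) = L<n

  FracLE-intro : ∀ s (f : Series) → (∀ (r : Fin s) → f -[1+ toℕ r ] ≈ 0#) → FracLE f -[1+ s ]
  FracLE-intro s f vanishes (+ n)    _         = refl
  FracLE-intro s f vanishes -[1+ k ] (-<- k<s) = begin
    f -[1+ k ]                      ≡⟨ ≡.cong (λ k → f -[1+ k ]) (toℕ-fromℕ< k<s) ⟨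
    f -[1+ toℕ (fromℕ< k<s) ]       ≈⟨ vanishes (fromℕ< k<s) ⟩
    0#                              ∎

  -[2+t]+t≡-2 : ∀ t → -[1+ suc t ] ℤ.+ + t ≡ -[1+ 1 ]
  -[2+t]+t≡-2 t = ≡.trans (ℤ.⊖-≤ (ℕ.m≤n+m t 2)) (≡.cong (λ k → ℤ.- + k) (ℕ.m+n∸n≡m 2 t))

  -[2+t]+t+[1+s]≡s-1 : ∀ t s → -[1+ suc t ] ℤ.+ + t ℤ.+ + suc s ≡ + s ℤ.- + 1
  -[2+t]+t+[1+s]≡s-1 t s =
    ≡.trans (≡.cong (ℤ._+ + suc s) (-[2+t]+t≡-2 t)) (ℤ.[1+m]⊖[1+n]≡m⊖n s 1)

  module Truncation (m n : ℕ) (A : Fin n → Fin m → Series) (α : Fin n → Series) (s′ t : ℕ) where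

    Rows : FiniteIndex (Fin n × Fin s′)
    Rows = ×-finiteIndex (finIndex n) (finIndex s′)

    Cols : FiniteIndex (Fin m × Fin (suc t))
    Cols = ×-finiteIndex (finIndex m) (finIndex (suc t))

    -- The coefficient of z^{-1-r} in L_i(Σ_d x_{j,d} z^d) is Σ_{j,d} A_{i,j}[-1-r-d] x_{j,d}.
    matrix : Fin n × Fin s′ → Fin m × Fin (suc t) → Carrier
    matrix (i , r) (j , d) = A i j -[1+ (toℕ r ℕ.+ toℕ d) ]

    target : Fin n × Fin s′ → Carrier
    target (i , r) = α i -[1+ toℕ r ]

    Approximation : Set (c ⊔ ℓ)
    Approximation = Σ (Fin m → Poly) λ b →
      (∀ i → FracLE (Lform n m A b i ⊖ α i) -[1+ s′ ]) × (∀ j → PNormLE (b j) (+ t))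

    approximation : Solution Rows Cols matrix target → Approximation
    approximation (x , solves) =
      b , (λ i → FracLE-intro s′ _ (approximates i)) , (λ j → PNormLE-tabulate (suc t) (coefficients j))
      where
      coefficients : Fin m → Fin (suc t) → Carrier
      coefficients j d = x (j , d)
      b : Fin m → Poly
      b j = tabulate (coefficients j)
      approximates : ∀ i r → (Lform n m A b i ⊖ α i) -[1+ toℕ r ] ≈ 0#
      approximates i r = begin
        Lform n m A b i -[1+ toℕ r ] - α i -[1+ toℕ r ]
          ≡⟨ ≡.cong (_- α i -[1+ toℕ r ])
               (coeff-combination m (suc t) coefficients (A i) (toℕ r)) ⟩
        FiniteIndex.∑ Cols (λ v → x v * matrix (i , r) v) - target (i , r)
          ≈⟨ +-congʳ (FiniteIndex.∑-cong Cols (λ v → *-comm (x v) (matrix (i , r) v))) ⟩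
        FiniteIndex.∑ Cols (λ v → matrix (i , r) v * x v) - target (i , r)
          ≈⟨ +-congʳ (solves (i , r)) ⟩
        target (i , r) - target (i , r)
          ≈⟨ -‿inverseʳ _ ⟩
        0# ∎

    Transference : Set (c ⊔ ℓ)
    Transference = (u : Fin n → Poly) (e : ℤ) →
      (∀ j → FracLE (Mform n m A u j) e) →
      (∀ i → PNormLE (u i) (e ℤ.+ + t ℤ.+ + suc s′)) →
      FracLE (uDotα n u α) (e ℤ.+ + t)

    no-obstruction : Transference → ¬ Obstruction Rows Cols matrix target
    no-obstruction transference (μ , annihilates , unpaired) = unpaired (begin
      FiniteIndex.∑ Rows (λ v → μ v * target v)
        ≡⟨ coeff-combination n s′ (λ i r → μ (i , r)) α 0 ⟨
      uDotα n u α -[1+ 0 ]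
        ≈⟨ transference u e small-M small-u -[1+ 0 ] e+t<-1 ⟩
      0# ∎)
      where
      u : Fin n → Poly
      u i = tabulate (λ r → μ (i , r))
      -- e + t = −2 exposes the z^{-1}-coefficient, and e + t + s = s − 2 bounds deg u_i.
      e : ℤ
      e = -[1+ suc t ]
      e+t<-1 : e ℤ.+ + t < -[1+ 0 ]
      e+t<-1 = ≡.subst (_< -[1+ 0 ]) (≡.sym (-[2+t]+t≡-2 t)) (-<- (s≤s z≤n))
      small-M : ∀ j → FracLE (Mform n m A u j) e
      small-M j = FracLE-intro (suc t) _ λ d → begin
        Mform n m A u j -[1+ toℕ d ]
          ≡⟨ coeff-combination n s′ (λ i r → μ (i , r)) (λ i → A i j) (toℕ d) ⟩
        sum (λ i → sum (λ r → μ (i , r) * A i j -[1+ (toℕ d ℕ.+ toℕ r) ]))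
          ≡⟨ sum-cong-≗ (λ i → sum-cong-≗ (λ r →
               ≡.cong (λ k → μ (i , r) * A i j -[1+ k ]) (ℕ.+-comm (toℕ d) (toℕ r)))) ⟩
        FiniteIndex.∑ Rows (λ v → μ v * matrix v (j , d))
          ≈⟨ annihilates (j , d) ⟩
        0# ∎
      small-u : ∀ i → PNormLE (u i) (e ℤ.+ + t ℤ.+ + suc s′)
      small-u i = ≡.subst (PNormLE (u i)) (≡.sym (-[2+t]+t+[1+s]≡s-1 t s′)) (PNormLE-tabulate s′ _)

    approximable : Transference → Approximation
    approximable transference with fredholm-alternative Rows Cols matrix target
    ... | inj₁ solution    = approximation solution
    ... | inj₂ obstruction = ⊥-elim (no-obstruction transference obstruction)

open import Data.Integer using (-_; _+_)

corollary4p2 : {c ℓ : Level} (F : FiniteField c ℓ) →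
    let open FieldOps F in
    (m n : ℕ) → 1 ≤ m → 1 ≤ n →
    (A : Fin n → Fin m → Series) → (∀ i j → IsLaurent (A i j)) →
    (α : Fin n → Series) → (∀ i → IsLaurent (α i)) →
    (s t : ℕ) → 1 ≤ s → 1 ≤ t →
    -- |⟨u·α⟩| ≤ max{ q^t max_j |⟨M_j(u)⟩| , q^(-s) max_i ‖u_i‖ }  for all u,
    -- expressed as: for every e ∈ ℤ, if max_j |⟨M_j(u)⟩| ≤ q^e and
    -- max_i ‖u_i‖ ≤ q^(e+t+s) then |⟨u·α⟩| ≤ q^(e+t)
    ((u : Fin n → Poly) → (e : ℤ) →
      (∀ j → FracLE (Mform n m A u j) e) →
      (∀ i → PNormLE (u i) (e + + t + + s)) →
      FracLE (uDotα n u α) (e + + t)) →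
    Σ (Fin m → Poly) (λ b →
      (∀ i → FracLE (Lform n m A b i ⊖ α i) (- (+ s))) ×
      (∀ j → PNormLE (b j) (+ t)))
corollary4p2 F m n _ _ A _ α _ zero     t () _ _
corollary4p2 F m n _ _ A _ α _ (suc s′) t _  _ transference =
  Truncation.approximable F m n A α s′ t transference
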